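{- Let $T=T_\ell$ be the triangulation on $n=2^\ell+2$ vertices described in the context. The number of maximal upward paths in $T$ is $O(n^{\log 3})$, and the number of upward paths in $T$ is $O(n^{\log 3}\log n)=O(n^{1.585})$.
   Context: Logarithms are base 2. For an integer $\ell\ge 0$, $T_\ell$ is the following triangulation on $n=2^\ell+2$ points. The outer face is a triangle $oab$ where $o$ is the origin, $a$ and $b$ lie one on each of the rays from $o$ in directions $\pi/4$ and $3\pi/4$, and $ab$ is horizontal (so $\angle aob=\pi/2$). There are $\ell$ circles $C_0,\dots,C_{\ell-1}$ centered at $o$ with rapidly decreasing radii, all inside the triangle; on $C_i$ there are $2^i$ points, lying on the rays from $o$ in directions $\frac{\pi}{4}+\frac{2j-1}{4\cdot 2^i}\pi$, $j=1,\dots,2^i$. Edges: $ab$, $oa$, $ob$; $o$ is joined to every other vertex; each vertex on $C_i$ is joined to the two vertices among $\{a,b\}\cup C_0\cup\dots\cup C_{i-1}$ that are closest to it in angular order around $o$ (one on each side). The radii are chosen recursively so that whenever $v\in C_i$ is joined to $v'$ and $v''$ on larger circles or in $\{a,b\}$, we have $\angle vv'o<\pi/2^{\ell+1}$ and $\angle vv''o<\pi/2^{\ell+1}$. A (directed) path is upward if it is monotone in direction $(0,1)$, i.e., the $y$-coordinate strictly increases along each edge, and downward if it is monotone in direction $(0,-1)$. An upward path is maximal if it is not strictly contained in another upward path. -}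

module Defs where

open import Data.Nat using (ℕ; suc; _+_; _*_; _^_; _<_)
open import Data.Fin using (Fin; toℕ)
open import Data.Maybe using (Maybe; nothing; just)
open import Data.List using (List; [])
open import Data.List.Relation.Unary.Linked using (Linked)
open import Data.List.Relation.Binary.Infix.Heterogeneous using (Infix)
open import Data.Sum using (_⊎_)
open import Data.Product using (_×_)
open import Relation.Binary.PropositionalEquality using (_≡_; _≢_)

-- Vertices of T_ℓ.  'nothing' is the origin o.  'just k' (k = 0 … 2^ℓ) is the
-- vertex lying on the ray from o in direction π/4 + (k / 2^ℓ)·(π/2):
--   k = 0 is a (direction π/4), k = 2^ℓ is b (direction 3π/4), and
--   k = (2q+1)·2^s with 0 < k < 2^ℓ is the point of circle C_{ℓ-s-1}
--   (direction π/4 + (2j-1)π/(4·2^i) with i = ℓ-s-1, j = q+1).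
V : ℕ → Set
V ℓ = Maybe (Fin (suc (2 ^ ℓ)))

-- Upward (y strictly increasing) directed edges of T_ℓ.
--  * o is joined to every other vertex, and o has the smallest y-coordinate.
--  * a vertex k = (2q+1)·2^s on C_{ℓ-s-1} is joined to its two angular
--    neighbours k ± 2^s among {a,b} ∪ C_0 ∪ … ∪ C_{ℓ-s-2}; by the angle
--    condition on the radii these edges go upward from k.
--  * the edge ab is horizontal, hence neither upward nor downward.
data Up (ℓ : ℕ) : V ℓ → V ℓ → Set where
  from-o : (k : Fin (suc (2 ^ ℓ))) → Up ℓ nothing (just k)
  outward : (k k′ : Fin (suc (2 ^ ℓ))) (q s : ℕ) →
            toℕ k ≡ (1 + 2 * q) * 2 ^ s →
            toℕ k < 2 ^ ℓ →
            (toℕ k′ ≡ toℕ k + 2 ^ s ⊎ toℕ k′ + 2 ^ s ≡ toℕ k) →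
            Up ℓ (just k) (just k′)

UpPath : (ℓ : ℕ) → List (V ℓ) → Set
UpPath ℓ p = p ≢ [] × Linked (Up ℓ) p

MaxUpPath : (ℓ : ℕ) → List (V ℓ) → Set
MaxUpPath ℓ p = UpPath ℓ p ×
  ((q : List (V ℓ)) → UpPath ℓ q → Infix _≡_ p q → p ≡ q)

-- A vertex k = (1 + 2q)·2^s with
-- 0 < k < 2^ℓ has upward edges only to k ± 2^s, which are multiples of 2^(s+1), and a and b have
-- none. So the level s strictly increases along an upward path avoiding o, and such a path ending
-- at a or b is determined by its last vertex and the levels it uses, each with a sign: there are
-- at most 2·3^ℓ of them, each with at most ℓ + 1 vertices. A maximal upward path is o followed by
-- such a path, and every upward path, after prepending o if necessary, is a prefix of a maximal
-- one. Both bounds follow by injecting the paths into the resulting explicit lists.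

module Submission where

open import Defs
open import Data.Nat using (ℕ; _+_; _*_; _^_; _≤_)
open import Data.List using (List; length)
open import Data.List.Relation.Unary.All using (All)
open import Data.List.Relation.Unary.Unique.Propositional using (Unique)
open import Data.Product using (_×_; ∃)

open import Data.Bool using (Bool; true; false)
open import Data.Empty using (⊥-elim)
open import Data.Fin using (Fin; toℕ; fromℕ<) renaming (zero to fzero; _<_ to _<ᶠ_; _>_ to _>ᶠ_)
open import Data.Fin.Induction using (>-wellFounded)
open import Data.Fin.Properties using (toℕ-injective; toℕ<n; toℕ-fromℕ<)
open import Data.List using ([]; _∷_; _++_; map; take; drop; upTo; cartesianProductWith)
open import Data.List.Membership.DecPropositional Data.Nat._≟_ using (_∈?_)
open import Data.List.Membership.Propositional using (_∈_; _∉_)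
open import Data.List.Membership.Propositional.Properties using (∈-++⁺ˡ; ∈-++⁺ʳ; ∈-++⁻; ∈-map⁺; ∈-map⁻; ∈-∃++; ∈-upTo⁺; ∈-cartesianProductWith⁺)
open import Data.List.NonEmpty as List⁺ using (List⁺; _∷_; _∷⁺_; head; toList)
open import Data.List.Properties using (length-++; length-map; length-upTo; length-++-sucʳ; map-++; map-∘; map-injective; ++-identityʳ-unique)
open import Data.List.Relation.Binary.Infix.Heterogeneous using (Infix; here; there; _ⁱ++_)
open import Data.List.Relation.Binary.Pointwise.Properties as Pointwise using ()
open import Data.List.Relation.Binary.Prefix.Heterogeneous using ([]; _∷_)
open import Data.List.Relation.Binary.Prefix.Heterogeneous.Properties using (fromPointwise)
open import Data.List.Relation.Binary.Subset.Propositional using (_⊆_)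
import Data.List.Relation.Unary.All as All
open import Data.List.Relation.Unary.AllPairs using ([]; _∷_)
open import Data.List.Relation.Unary.Any using (here; there)
open import Data.List.Relation.Unary.Linked using (Linked; [-]; _∷_)
import Data.List.Relation.Unary.Unique.Propositional.Properties as Unique
import Data.Maybe as Maybe
open import Data.Maybe using (Maybe; just; nothing)
open import Data.Maybe.Properties using () renaming (map-injective to maybe-map-injective)
open import Data.Nat using (zero; suc; _∸_; _<_; z≤n; s≤s; z<s)
open import Data.Nat.Divisibility using (_∣_; divides; 1∣_; m∣m*n; ∣-trans; *-cancelʳ-∣)
open import Data.Nat.Induction using (<-wellFounded)
open import Data.Nat.Properties
open import Data.Nat.Tactic.RingSolver using (solve-∀)
open import Data.Product using (∃₂; _,_)
open import Data.Sum using (_⊎_; inj₁; inj₂)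
open import Function using (_∘_; _$_; id; case_of_)
open import Induction.WellFounded using (Acc; acc)
open import Relation.Binary.PropositionalEquality
open import Relation.Nullary using (¬_; yes; no)

private
  variable
    A B C : Set
    y : A
    xs ys : List A

Unique∧⊆⇒length≤ : Unique xs → xs ⊆ ys → length xs ≤ length ys
Unique∧⊆⇒length≤ [] _ = z≤n
Unique∧⊆⇒length≤ {xs = x ∷ xs} (x∉xs ∷ u) xs⊆ys with ∈-∃++ (xs⊆ys (here refl))
... | us , vs , refl = begin
    suc (length xs)          ≤⟨ s≤s (Unique∧⊆⇒length≤ u xs⊆us++vs) ⟩
    suc (length (us ++ vs))  ≡⟨ length-++-sucʳ us x vs ⟨
    length (us ++ x ∷ vs)    ∎
  where
  open ≤-Reasoning
  ∈-without-x : y ∈ us ++ x ∷ vs → x ≢ y → y ∈ us ++ vs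
  ∈-without-x y∈ x≢y with ∈-++⁻ us y∈
  ... | inj₁ y∈us = ∈-++⁺ˡ y∈us
  ... | inj₂ (here refl) = ⊥-elim (x≢y refl)
  ... | inj₂ (there y∈vs) = ∈-++⁺ʳ us y∈vs
  xs⊆us++vs : xs ⊆ us ++ vs
  xs⊆us++vs y∈xs = ∈-without-x (xs⊆ys (there y∈xs)) (All.lookup x∉xs y∈xs)

injective⇒length≤ : {f : A → B} → (∀ {x y} → f x ≡ f y → x ≡ y) →
                    Unique xs → All (λ x → f x ∈ ys) xs → length xs ≤ length ys
injective⇒length≤ {xs = xs} {f = f} f-inj u f[xs]∈ys =
  subst (_≤ _) (length-map f xs) (Unique∧⊆⇒length≤ (Unique.map⁺ f-inj u) f[xs]⊆ys)
  where
  f[xs]⊆ys : map f xs ⊆ _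
  f[xs]⊆ys y∈ with ∈-map⁻ f y∈
  ... | x , x∈xs , refl = All.lookup f[xs]∈ys x∈xs

length-cartesianProductWith : (f : A → B → C) (xs : List A) (ys : List B) →
                              length (cartesianProductWith f xs ys) ≡ length xs * length ys
length-cartesianProductWith f []       ys = refl
length-cartesianProductWith f (x ∷ xs) ys = begin
  length (map (f x) ys ++ cartesianProductWith f xs ys)        ≡⟨ length-++ (map (f x) ys) ⟩
  length (map (f x) ys) + length (cartesianProductWith f xs ys) ≡⟨ cong₂ _+_ (length-map (f x) ys) (length-cartesianProductWith f xs ys) ⟩
  length ys + length xs * length ys                             ∎
  where open ≡-Reasoning

prefixes : ℕ → List (List A) → List (List A)
prefixes n = cartesianProductWith take (upTo (suc n))

length-prefixes : ∀ n (xss : List (List A)) → length (prefixes n xss) ≡ suc n * length xss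
length-prefixes n xss = trans (length-cartesianProductWith take (upTo (suc n)) xss)
                              (cong (_* length xss) (length-upTo (suc n)))

∈-prefixes : ∀ {n} {xss : List (List A)} → xs ++ ys ∈ xss → length xs ≤ n → xs ∈ prefixes n xss
∈-prefixes {xs = xs} {ys} xs++ys∈ ∣xs∣≤n =
  subst (_∈ _) (take-length-++ xs ys) (∈-cartesianProductWith⁺ take (∈-upTo⁺ (s≤s ∣xs∣≤n)) xs++ys∈)
  where
  take-length-++ : ∀ (xs ys : List A) → take (length xs) (xs ++ ys) ≡ xs
  take-length-++ []       ys = refl
  take-length-++ (x ∷ xs) ys = cong (x ∷_) (take-length-++ xs ys)

infix-refl : Infix _≡_ xs xs
infix-refl = here (fromPointwise (Pointwise.refl refl))

^-monoʳ-∣ : ∀ m {n o} → n ≤ o → m ^ n ∣ m ^ o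
^-monoʳ-∣ m {n} {o} n≤o = subst (m ^ n ∣_) m^n*m^[o∸n]≡m^o (m∣m*n (m ^ (o ∸ n)))
  where
  m^n*m^[o∸n]≡m^o : m ^ n * m ^ (o ∸ n) ≡ m ^ o
  m^n*m^[o∸n]≡m^o = trans (sym (^-distribˡ-+-* m n (o ∸ n))) (cong (m ^_) (m+[n∸m]≡n n≤o))

d∣m∧d∣n∧m<n⇒m+d≤n : ∀ {d m n} → d ∣ m → d ∣ n → m < n → m + d ≤ n
d∣m∧d∣n∧m<n⇒m+d≤n {d} (divides i refl) (divides j refl) id<jd = begin
  i * d + d ≡⟨ +-comm (i * d) d ⟩
  suc i * d ≤⟨ *-monoˡ-≤ d (*-cancelʳ-< d i j id<jd) ⟩
  j * d     ∎
  where open ≤-Reasoning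

even⊎odd : ∀ n → ∃ λ h → n ≡ 2 * h ⊎ n ≡ 1 + 2 * h
even⊎odd zero = 0 , inj₁ refl
even⊎odd (suc n) with even⊎odd n
... | h , inj₁ refl = h , inj₂ refl
... | h , inj₂ refl = suc h , inj₁ (2+2h≡2*[1+h] h)
  where
  2+2h≡2*[1+h] : ∀ h → 2 + 2 * h ≡ 2 * suc h
  2+2h≡2*[1+h] = solve-∀

dyadic-decomposition : ∀ n → 0 < n → ∃₂ λ q s → n ≡ (1 + 2 * q) * 2 ^ s
dyadic-decomposition n = go n (<-wellFounded n)
  where
  double : ∀ q z → 2 * ((1 + 2 * q) * z) ≡ (1 + 2 * q) * (2 * z)
  double = solve-∀
  go : ∀ n → Acc _<_ n → 0 < n → ∃₂ λ q s → n ≡ (1 + 2 * q) * 2 ^ s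
  go n (acc rec) 0<n with even⊎odd n
  ... | h , inj₂ n≡1+2h = h , 0 , trans n≡1+2h (sym (*-identityʳ (1 + 2 * h)))
  ... | zero  , inj₁ refl = ⊥-elim (<-irrefl refl 0<n)
  ... | suc h , inj₁ refl with go (suc h) (rec (m<m+n (suc h) z<s)) z<s
  ...   | q , s , h≡ = q , suc s , trans (cong (2 *_) h≡) (double q (2 ^ s))

module _ {x : ℕ} (q s : ℕ) (x≡ : x ≡ (1 + 2 * q) * 2 ^ s) where

  x<2^ℓ⇒s<ℓ : ∀ {ℓ} → x < 2 ^ ℓ → s < ℓ
  x<2^ℓ⇒s<ℓ {ℓ} x<2^ℓ = ≰⇒> λ ℓ≤s → <⇒≱ x<2^ℓ (begin
    2 ^ ℓ               ≤⟨ ^-monoʳ-≤ 2 ℓ≤s ⟩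
    2 ^ s               ≤⟨ m≤n*m (2 ^ s) (1 + 2 * q) ⟩
    (1 + 2 * q) * 2 ^ s ≡⟨ x≡ ⟨
    x                   ∎)
    where open ≤-Reasoning

  x<2^ℓ⇒x+2^s≤2^ℓ : ∀ {ℓ} → x < 2 ^ ℓ → x + 2 ^ s ≤ 2 ^ ℓ
  x<2^ℓ⇒x+2^s≤2^ℓ {ℓ} x<2^ℓ =
    d∣m∧d∣n∧m<n⇒m+d≤n (divides (1 + 2 * q) x≡) (^-monoʳ-∣ 2 (<⇒≤ (x<2^ℓ⇒s<ℓ {ℓ} x<2^ℓ))) x<2^ℓ

  2^m∣x⇒m≤s : ∀ {m} → 2 ^ m ∣ x → m ≤ s
  2^m∣x⇒m≤s {m} 2^m∣x = ≮⇒≥ λ s<m →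
    2∤1+2q (*-cancelʳ-∣ (2 ^ s) {{m^n≢0 2 s}} (∣-trans (^-monoʳ-∣ 2 s<m) (subst (2 ^ m ∣_) x≡ 2^m∣x)))
    where
    2∤1+2q : ¬ (2 ∣ 1 + 2 * q)
    2∤1+2q (divides p 1+2q≡p*2) = even≢odd p q (trans (*-comm 2 p) (sym 1+2q≡p*2))

  2^[1+s]∣x±2^s : ∀ {y} → y ≡ x + 2 ^ s ⊎ y + 2 ^ s ≡ x → 2 ^ suc s ∣ y
  2^[1+s]∣x±2^s {y} (inj₁ y≡x+2^s) = divides (suc q) (begin
    y                           ≡⟨ y≡x+2^s ⟩
    x + 2 ^ s                   ≡⟨ cong (_+ 2 ^ s) x≡ ⟩
    (1 + 2 * q) * 2 ^ s + 2 ^ s ≡⟨ up q (2 ^ s) ⟩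
    suc q * 2 ^ suc s           ∎)
    where
    open ≡-Reasoning
    up : ∀ q z → (1 + 2 * q) * z + z ≡ suc q * (2 * z)
    up = solve-∀
  2^[1+s]∣x±2^s {y} (inj₂ y+2^s≡x) = divides q (+-cancelʳ-≡ (2 ^ s) y (q * 2 ^ suc s) (begin
    y + 2 ^ s             ≡⟨ y+2^s≡x ⟩
    x                     ≡⟨ x≡ ⟩
    (1 + 2 * q) * 2 ^ s   ≡⟨ down q (2 ^ s) ⟩
    q * 2 ^ suc s + 2 ^ s ∎))
    where
    open ≡-Reasoning
    down : ∀ q z → (1 + 2 * q) * z ≡ q * (2 * z) + z
    down = solve-∀

-- A code lists steps by level and direction: (s , true) goes from x to x + 2^s and (s , false)
-- from x to x ∸ 2^s. trace d e is the path taking the steps of d in turn and ending at e.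
Code : Set
Code = List (ℕ × Bool)

unstep : Bool → ℕ → ℕ → ℕ
unstep true  s y = y ∸ 2 ^ s
unstep false s y = y + 2 ^ s

trace : Code → ℕ → List⁺ ℕ
trace []            e = e ∷ []
trace ((s , b) ∷ d) e = unstep b s (head (trace d e)) ∷⁺ trace d e

length-trace : ∀ d e → List⁺.length (trace d e) ≡ suc (length d)
length-trace []            e = refl
length-trace ((s , b) ∷ d) e = cong suc (length-trace d e)

unstep-inverse : ∀ {x y s} → y ≡ x + 2 ^ s ⊎ y + 2 ^ s ≡ x → ∃ λ b → unstep b s y ≡ x
unstep-inverse {x} {s = s} (inj₁ refl) = true , m+n∸n≡m x (2 ^ s)
unstep-inverse             (inj₂ refl) = false , refl

data Ascending (n : ℕ) : ℕ → Code → Set where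
  []   : ∀ {m} → Ascending n m []
  cons : ∀ {m s b d} → m ≤ s → s < n → Ascending n (suc s) d → Ascending n m ((s , b) ∷ d)

levelChoices : ℕ → List (Code → Code)
levelChoices m = id ∷ ((m , true) ∷_) ∷ ((m , false) ∷_) ∷ []

ascendingCodes : ℕ → ℕ → List Code
ascendingCodes m zero    = [] ∷ []
ascendingCodes m (suc c) = cartesianProductWith _$_ (levelChoices m) (ascendingCodes (suc m) c)

length-ascendingCodes : ∀ m c → length (ascendingCodes m c) ≡ 3 ^ c
length-ascendingCodes m zero    = refl
length-ascendingCodes m (suc c) =
  trans (length-cartesianProductWith _$_ (levelChoices m) (ascendingCodes (suc m) c))
        (cong (3 *_) (length-ascendingCodes (suc m) c))

∈-ascendingCodes : ∀ m c {d} → Ascending (m + c) m d → d ∈ ascendingCodes m c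
∈-ascendingCodes m zero    []                 = here refl
∈-ascendingCodes m zero    (cons m≤s s<m+0 _) = ⊥-elim (<-irrefl (sym (+-identityʳ m)) (≤-<-trans m≤s s<m+0))
∈-ascendingCodes m (suc c) {d} asc            = go (subst (λ n → Ascending n m d) (+-suc m c) asc)
  where
  skip : ∀ {d} → Ascending (suc m + c) (suc m) d → d ∈ ascendingCodes m (suc c)
  skip asc = ∈-cartesianProductWith⁺ _$_ {levelChoices m} (here refl) (∈-ascendingCodes (suc m) c asc)
  go : ∀ {d} → Ascending (suc m + c) m d → d ∈ ascendingCodes m (suc c)
  go [] = skip []
  go (cons {b = b} m≤s s<n asc) with m≤n⇒m<n∨m≡n m≤s
  ... | inj₁ m<s  = skip (cons m<s s<n asc)
  ... | inj₂ refl =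
    ∈-cartesianProductWith⁺ _$_ {levelChoices m} (there (use b)) (∈-ascendingCodes (suc m) c asc)
    where
    use : ∀ b → ((m , b) ∷_) ∈ drop 1 (levelChoices m)
    use true  = here refl
    use false = there (here refl)

Ascending⇒length≤ : ∀ {n m d} → Ascending n m d → length d ≤ n ∸ m
Ascending⇒length≤ []                 = z≤n
Ascending⇒length≤ {n} (cons {s = s} m≤s s<n asc) =
  ≤-trans (s≤s (Ascending⇒length≤ asc)) (≤-trans (∸-monoʳ-< (n<1+n s) s<n) (∸-monoʳ-≤ n m≤s))

Ray : ℕ → Set
Ray ℓ = Fin (suc (2 ^ ℓ))

sinks : ℕ → List ℕ
sinks ℓ = 0 ∷ 2 ^ ℓ ∷ []

data PathToSink (ℓ : ℕ) : Ray ℓ → List (Ray ℓ) → Set where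
  at-sink : ∀ {k} → toℕ k ∈ sinks ℓ → PathToSink ℓ k []
  _∷_     : ∀ {k k′ ks} → Up ℓ (just k) (just k′) → PathToSink ℓ k′ ks → PathToSink ℓ k (k′ ∷ ks)

-- Forgetting the bound on ray indices lets paths be compared with lists computed from codes.
erase : ∀ {n} → List (Maybe (Fin n)) → List (Maybe ℕ)
erase = map (Maybe.map toℕ)

erase-injective : ∀ {n} {p p′ : List (Maybe (Fin n))} → erase p ≡ erase p′ → p ≡ p′
erase-injective = map-injective (maybe-map-injective toℕ-injective)

sinkPath : ℕ → Code → List (Maybe ℕ)
sinkPath e d = map just (toList (trace d e))

sinkPaths : ℕ → List (List (Maybe ℕ))
sinkPaths ℓ = cartesianProductWith sinkPath (sinks ℓ) (ascendingCodes 0 ℓ)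

maximalPaths : ℕ → List (List (Maybe ℕ))
maximalPaths ℓ = map (nothing ∷_) (sinkPaths ℓ)

upPathCandidates : ℕ → List (List (Maybe ℕ))
upPathCandidates ℓ = prefixes (2 + ℓ) (maximalPaths ℓ ++ map (drop 1) (maximalPaths ℓ))

module _ {ℓ : ℕ} where

  Up-from-non-sink : (k : Ray ℓ) → toℕ k ∉ sinks ℓ → ∃ λ k′ → k <ᶠ k′ × Up ℓ (just k) (just k′)
  Up-from-non-sink k k∉sinks with dyadic-decomposition (toℕ k) (n≢0⇒n>0 λ k≡0 → k∉sinks (here k≡0))
  ... | q , s , k≡ = fromℕ< k+2^s<1+2^ℓ , k<k′ , outward k _ q s k≡ k<2^ℓ (inj₁ (toℕ-fromℕ< k+2^s<1+2^ℓ))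
    where
    k<2^ℓ : toℕ k < 2 ^ ℓ
    k<2^ℓ = ≤∧≢⇒< (≤-pred (toℕ<n k)) λ k≡2^ℓ → k∉sinks (there (here k≡2^ℓ))
    k+2^s<1+2^ℓ : toℕ k + 2 ^ s < suc (2 ^ ℓ)
    k+2^s<1+2^ℓ = s≤s (x<2^ℓ⇒x+2^s≤2^ℓ q s k≡ {ℓ} k<2^ℓ)
    k<k′ : toℕ k < toℕ (fromℕ< k+2^s<1+2^ℓ)
    k<k′ = subst (toℕ k <_) (sym (toℕ-fromℕ< k+2^s<1+2^ℓ)) (m<m+n (toℕ k) (m^n>0 2 s))

  reach-sink : (k : Ray ℓ) → ∃ (PathToSink ℓ k)
  reach-sink k = go k (>-wellFounded k)
    where
    go : (k : Ray ℓ) → Acc _>ᶠ_ k → ∃ (PathToSink ℓ k)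
    go k (acc rec) with toℕ k ∈? sinks ℓ
    ... | yes k∈sinks = [] , at-sink k∈sinks
    ... | no k∉sinks with Up-from-non-sink k k∉sinks
    ...   | k′ , k<k′ , u with go k′ (rec k<k′)
    ...     | ks , path = k′ ∷ ks , u ∷ path

  extend-to-sink : ∀ {k xs} → Linked (Up ℓ) (just k ∷ xs) →
                   ∃₂ λ ys ks → xs ++ ys ≡ map just ks × PathToSink ℓ k ks
  extend-to-sink {k} {[]} [-] with reach-sink k
  ... | ks , path = map just ks , ks , refl , path
  extend-to-sink {xs = nothing ∷ _} (() ∷ _)
  extend-to-sink {xs = just k′ ∷ xs} (u ∷ l) with extend-to-sink l
  ... | ys , ks , xs++ys≡ks , path = ys , k′ ∷ ks , cong (just k′ ∷_) xs++ys≡ks , u ∷ path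

  unextendable⇒PathToSink : ∀ {k xs} → Linked (Up ℓ) (just k ∷ xs) →
                            (∀ v → ¬ Linked (Up ℓ) (just k ∷ xs ++ v ∷ [])) →
                            ∃ λ ks → xs ≡ map just ks × PathToSink ℓ k ks
  unextendable⇒PathToSink {k} {[]} [-] stuck with toℕ k ∈? sinks ℓ
  ... | yes k∈sinks = [] , refl , at-sink k∈sinks
  ... | no k∉sinks with Up-from-non-sink k k∉sinks
  ...   | k′ , _ , u = ⊥-elim (stuck (just k′) (u ∷ [-]))
  unextendable⇒PathToSink {xs = nothing ∷ _} (() ∷ _) _
  unextendable⇒PathToSink {xs = just k′ ∷ xs} (u ∷ l) stuck
    with unextendable⇒PathToSink l (λ v l′ → stuck v (u ∷ l′))
  ... | ks , refl , path = k′ ∷ ks , refl , u ∷ path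

  maximal⇒PathToSink : ∀ {p} → MaxUpPath ℓ p →
                       ∃₂ λ k ks → p ≡ nothing ∷ just k ∷ map just ks × PathToSink ℓ k ks
  maximal⇒PathToSink {[]} ((p≢[] , _) , _) = ⊥-elim (p≢[] refl)
  maximal⇒PathToSink {just k ∷ xs} ((_ , l) , maximal)
    with maximal (nothing ∷ just k ∷ xs) ((λ ()) , from-o k ∷ l) (there infix-refl)
  ... | ()
  maximal⇒PathToSink {nothing ∷ []} (_ , maximal)
    with maximal (nothing ∷ just fzero ∷ []) ((λ ()) , from-o fzero ∷ [-]) (here (refl ∷ []))
  ... | ()
  maximal⇒PathToSink {nothing ∷ nothing ∷ _} ((_ , () ∷ _) , _)
  maximal⇒PathToSink {p@(nothing ∷ just k ∷ xs)} ((_ , _ ∷ l) , maximal)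
    with unextendable⇒PathToSink l (λ v l′ →
      p≢p++[v] v (maximal (p ++ v ∷ []) ((λ ()) , from-o k ∷ l′) (infix-refl ⁱ++ (v ∷ []))))
    where
    p≢p++[v] : ∀ v → p ≢ p ++ v ∷ []
    p≢p++[v] v p≡p++[v] = case ++-identityʳ-unique p p≡p++[v] of λ ()
  ... | ks , refl , path = k , ks , refl , path

  PathToSink⇒trace : ∀ {k ks} → PathToSink ℓ k ks →
    ∃₂ λ e d → e ∈ sinks ℓ × (∀ m → 2 ^ m ∣ toℕ k → Ascending ℓ m d) × toℕ k ∷ map toℕ ks ≡ trace d e
  PathToSink⇒trace {k} (at-sink k∈sinks) = toℕ k , [] , k∈sinks , (λ _ _ → []) , refl
  PathToSink⇒trace {k} {k′ ∷ ks} (outward _ _ q s k≡ k<2^ℓ dir ∷ path)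
    with PathToSink⇒trace path | unstep-inverse dir
  ... | e , d , e∈sinks , ascending , k′∷ks≡ | b , unstep≡k =
    e , (s , b) ∷ d , e∈sinks , ascending′ , (begin
      toℕ k ∷ toℕ k′ ∷ map toℕ ks                  ≡⟨ cong (_∷ toℕ k′ ∷ map toℕ ks) unstep≡k ⟨
      unstep b s (toℕ k′) ∷⁺ (toℕ k′ ∷ map toℕ ks) ≡⟨ cong (λ t → unstep b s (head t) ∷⁺ t) k′∷ks≡ ⟩
      trace ((s , b) ∷ d) e                        ∎)
    where
    open ≡-Reasoning
    ascending′ : ∀ m → 2 ^ m ∣ toℕ k → Ascending ℓ m ((s , b) ∷ d)
    ascending′ m 2^m∣k =
      cons (2^m∣x⇒m≤s q s k≡ 2^m∣k) (x<2^ℓ⇒s<ℓ q s k≡ k<2^ℓ)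
           (ascending (suc s) (2^[1+s]∣x±2^s q s k≡ dir))

  PathToSink⇒∈sinkPaths : ∀ {k ks} → PathToSink ℓ k ks → erase (just k ∷ map just ks) ∈ sinkPaths ℓ
  PathToSink⇒∈sinkPaths {k} {ks} path with PathToSink⇒trace path
  ... | e , d , e∈sinks , ascending , k∷ks≡ =
    subst (_∈ sinkPaths ℓ) erased
      (∈-cartesianProductWith⁺ sinkPath e∈sinks
        (∈-ascendingCodes 0 ℓ (ascending 0 (1∣ toℕ k))))
    where
    erased : map just (toList (trace d e)) ≡ erase (just k ∷ map just ks)
    erased = begin
      map just (toList (trace d e)) ≡⟨ cong (map just ∘ toList) k∷ks≡ ⟨
      map just (map toℕ (k ∷ ks))   ≡⟨ map-∘ (k ∷ ks) ⟨
      map (just ∘ toℕ) (k ∷ ks)     ≡⟨ map-∘ (k ∷ ks) ⟩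
      erase (map just (k ∷ ks))     ∎
      where open ≡-Reasoning

  PathToSink⇒length≤ : ∀ {k ks} → PathToSink ℓ k ks → length ks ≤ ℓ
  PathToSink⇒length≤ {k} {ks} path with PathToSink⇒trace path
  ... | e , d , _ , ascending , k∷ks≡ = begin
    length ks           ≡⟨ length-map toℕ ks ⟨
    length (map toℕ ks) ≡⟨ suc-injective (trans (cong List⁺.length k∷ks≡) (length-trace d e)) ⟩
    length d            ≤⟨ Ascending⇒length≤ (ascending 0 (1∣ toℕ k)) ⟩
    ℓ                   ∎
    where open ≤-Reasoning

  ray-path-prefix : ∀ {k xs} → Linked (Up ℓ) (just k ∷ xs) →
                    ∃ λ rest → erase (just k ∷ xs) ++ rest ∈ sinkPaths ℓ × length xs ≤ ℓ
  ray-path-prefix {k} {xs} l with extend-to-sink l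
  ... | ys , ks , xs++ys≡ks , path =
    erase ys , subst (_∈ sinkPaths ℓ) erased (PathToSink⇒∈sinkPaths path) , length-xs≤ℓ
    where
    erased : erase (just k ∷ map just ks) ≡ erase (just k ∷ xs) ++ erase ys
    erased = cong (just (toℕ k) ∷_) (trans (cong erase (sym xs++ys≡ks)) (map-++ _ xs ys))
    length-xs≤ℓ : length xs ≤ ℓ
    length-xs≤ℓ = begin
      length xs             ≤⟨ m≤m+n (length xs) (length ys) ⟩
      length xs + length ys ≡⟨ length-++ xs ⟨
      length (xs ++ ys)     ≡⟨ cong length xs++ys≡ks ⟩
      length (map just ks)  ≡⟨ length-map just ks ⟩
      length ks             ≤⟨ PathToSink⇒length≤ path ⟩
      ℓ                     ∎
      where open ≤-Reasoning

  o-path-prefix : ∀ {xs} → Linked (Up ℓ) (nothing ∷ xs) →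
                  ∃ λ rest → erase (nothing ∷ xs) ++ rest ∈ maximalPaths ℓ × length xs ≤ suc ℓ
  o-path-prefix {[]} [-] with ray-path-prefix {fzero} {[]} [-]
  ... | rest , ∈sinkPaths , _ = just 0 ∷ rest , ∈-map⁺ (nothing ∷_) ∈sinkPaths , z≤n
  o-path-prefix {nothing ∷ _} (() ∷ _)
  o-path-prefix {just k ∷ xs} (_ ∷ l) with ray-path-prefix l
  ... | rest , ∈sinkPaths , length-xs≤ℓ = rest , ∈-map⁺ (nothing ∷_) ∈sinkPaths , s≤s length-xs≤ℓ

  MaxUpPath⇒erase∈maximalPaths : ∀ {p} → MaxUpPath ℓ p → erase p ∈ maximalPaths ℓ
  MaxUpPath⇒erase∈maximalPaths maximal with maximal⇒PathToSink maximal
  ... | k , ks , refl , path = ∈-map⁺ (nothing ∷_) (PathToSink⇒∈sinkPaths path)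

  UpPath⇒erase∈upPathCandidates : ∀ {p} → UpPath ℓ p → erase p ∈ upPathCandidates ℓ
  UpPath⇒erase∈upPathCandidates {[]} (p≢[] , _) = ⊥-elim (p≢[] refl)
  UpPath⇒erase∈upPathCandidates {nothing ∷ xs} (_ , l) with o-path-prefix l
  ... | rest , ∈maximal , length-xs≤1+ℓ =
    ∈-prefixes (∈-++⁺ˡ ∈maximal) (s≤s (subst (_≤ suc ℓ) (sym (length-map _ xs)) length-xs≤1+ℓ))
  UpPath⇒erase∈upPathCandidates {just k ∷ xs} (_ , l) with o-path-prefix (from-o k ∷ l)
  ... | rest , ∈maximal , length-p≤1+ℓ =
    ∈-prefixes (∈-++⁺ʳ (maximalPaths ℓ) (∈-map⁺ (drop 1) ∈maximal))
               (m≤n⇒m≤1+n (subst (_≤ suc ℓ) (sym (cong suc (length-map _ xs))) length-p≤1+ℓ))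

length-sinkPaths : ∀ ℓ → length (sinkPaths ℓ) ≡ 2 * 3 ^ ℓ
length-sinkPaths ℓ = trans (length-cartesianProductWith sinkPath (sinks ℓ) (ascendingCodes 0 ℓ))
                           (cong (2 *_) (length-ascendingCodes 0 ℓ))

length-maximalPaths : ∀ ℓ → length (maximalPaths ℓ) ≡ 2 * 3 ^ ℓ
length-maximalPaths ℓ = trans (length-map (nothing ∷_) (sinkPaths ℓ)) (length-sinkPaths ℓ)

length-upPathCandidates≤ : ∀ ℓ → length (upPathCandidates ℓ) ≤ 12 * 3 ^ ℓ * (ℓ + 1)
length-upPathCandidates≤ ℓ = begin
  length (prefixes (2 + ℓ) (M ++ map (drop 1) M))    ≡⟨ length-prefixes (2 + ℓ) (M ++ map (drop 1) M) ⟩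
  (3 + ℓ) * length (M ++ map (drop 1) M)             ≡⟨ cong ((3 + ℓ) *_) (length-++ M) ⟩
  (3 + ℓ) * (length M + length (map (drop 1) M))     ≡⟨ cong (λ n → (3 + ℓ) * (length M + n)) (length-map (drop 1) M) ⟩
  (3 + ℓ) * (length M + length M)                    ≡⟨ cong (λ n → (3 + ℓ) * (n + n)) (length-maximalPaths ℓ) ⟩
  (3 + ℓ) * (2 * 3 ^ ℓ + 2 * 3 ^ ℓ)                 ≤⟨ m≤m+n _ (8 * 3 ^ ℓ * ℓ) ⟩
  (3 + ℓ) * (2 * 3 ^ ℓ + 2 * 3 ^ ℓ) + 8 * 3 ^ ℓ * ℓ ≡⟨ regroup (3 ^ ℓ) ℓ ⟩
  12 * 3 ^ ℓ * (ℓ + 1)                               ∎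
  where
  open ≤-Reasoning
  M : List (List (Maybe ℕ))
  M = maximalPaths ℓ
  regroup : ∀ x ℓ → (3 + ℓ) * (2 * x + 2 * x) + 8 * x * ℓ ≡ 12 * x * (ℓ + 1)
  regroup = solve-∀

lemma8 : (∃ λ (C : ℕ) → (ℓ : ℕ) (ps : List (List (V ℓ))) →
    Unique ps → All (MaxUpPath ℓ) ps → length ps ≤ C * 3 ^ ℓ)
    ×
    (∃ λ (C : ℕ) → (ℓ : ℕ) (ps : List (List (V ℓ))) →
    Unique ps → All (UpPath ℓ) ps → length ps ≤ C * 3 ^ ℓ * (ℓ + 1))
lemma8 =
  (2 , λ ℓ ps unique maximal → begin
    length ps                ≤⟨ injective⇒length≤ erase-injective unique (All.map MaxUpPath⇒erase∈maximalPaths maximal) ⟩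
    length (maximalPaths ℓ)  ≡⟨ length-maximalPaths ℓ ⟩
    2 * 3 ^ ℓ                ∎) ,
  (12 , λ ℓ ps unique up → begin
    length ps                    ≤⟨ injective⇒length≤ erase-injective unique (All.map UpPath⇒erase∈upPathCandidates up) ⟩
    length (upPathCandidates ℓ)  ≤⟨ length-upPathCandidates≤ ℓ ⟩
    12 * 3 ^ ℓ * (ℓ + 1)         ∎)
  where open ≤-Reasoning
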